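{- For every finite Abelian group $G$ with $|G|\ge3$, \[ \operatorname{NRD}(\operatorname{3LIN}^*_G,n)\ge\operatorname{NRD}(\operatorname{3LIN}^*_G\mid\operatorname{3LIN}_G,n)=\Omega(n^{1.5}). \]
   Context: $\operatorname{3LIN}_G=\{(x,y,z)\in G^3:x+y+z=0\}$ and $\operatorname{3LIN}^*_G=\operatorname{3LIN}_G\setminus\{(0,0,0)\}$. An instance $(X,Y)$ of $\operatorname{CSP}(P)$ for $P\subseteq D^r$ has a finite variable set $X$ and clauses $Y\subseteq X^r$; for $\sigma:X\to D$ write $\sigma(y)=(\sigma(y_1),\dots,\sigma(y_r))$. The instance is non-redundant if for each $y\in Y$ there is $\sigma_y$ with $\sigma_y(y)\notin P$ and $\sigma_y(y')\in P$ for all $y'\in Y\setminus\{y\}$; $\operatorname{NRD}(P,n)$ is the max $|Y|$ over such instances with $|X|=n$. For $P\subseteq Q\subseteq D^r$, the instance is $Q$-conditionally non-redundant if for each $y\in Y$ there is $\sigma_y:X\to D$ with $\sigma_y(y)\in Q\setminus P$ and $\sigma_y(y')\in P$ for all $y'\in Y\setminus\{y\}$; $\operatorname{NRD}(P\mid Q,n)$ is the max $|Y|$ over such instances with $n$ variables. -}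

module Defs where

open import Level using (Level; _⊔_)
open import Algebra.Bundles using (AbelianGroup)
open import Data.Nat using (ℕ; _≤_)
open import Data.Fin using (Fin)
open import Data.Product using (_×_; _,_; ∃-syntax)
open import Data.List using (List; length)
open import Data.List.Membership.Propositional using (_∈_)
open import Data.List.Relation.Unary.Unique.Propositional using (Unique)
open import Relation.Nullary using (¬_)
open import Relation.Binary.PropositionalEquality using (_≡_; _≢_)
import Relation.Binary.PropositionalEquality as ≡
open import Function.Bundles using (Bijection)

Rel3 : ∀ {a} (D : Set a) (ℓ : Level) → Set (a ⊔ Level.suc ℓ)
Rel3 D ℓ = D → D → D → Set ℓ

Clause : ℕ → Set
Clause n = Fin n × Fin n × Fin n

Sat : ∀ {a ℓ} {D : Set a} {n : ℕ} → Rel3 D ℓ → (Fin n → D) → Clause n → Set ℓ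
Sat P σ (i , j , k) = P (σ i) (σ j) (σ k)

-- Non-redundant instance (X = Fin n, clause set Y given as a duplicate-free list)
NonRedundant : ∀ {a ℓ} {D : Set a} {n : ℕ} → Rel3 D ℓ → List (Clause n) → Set (a ⊔ ℓ)
NonRedundant {D = D} {n} P Y =
  Unique Y ×
  (∀ y → y ∈ Y → ∃[ σ ] (¬ Sat P σ y × (∀ y′ → y′ ∈ Y → y′ ≢ y → Sat P σ y′)))

-- Q-conditionally non-redundant instance (P ⊆ Q)
CondNonRedundant : ∀ {a ℓ ℓ′} {D : Set a} {n : ℕ} → Rel3 D ℓ → Rel3 D ℓ′ →
                   List (Clause n) → Set (a ⊔ ℓ ⊔ ℓ′)
CondNonRedundant {D = D} {n} P Q Y =
  Unique Y ×
  (∀ y → y ∈ Y → ∃[ σ ] ((Sat Q σ y × ¬ Sat P σ y) × (∀ y′ → y′ ∈ Y → y′ ≢ y → Sat P σ y′)))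

-- NRD(P, n) ≥ k  (NRD is a maximum over a finite nonempty family)
NRD≥ : ∀ {a ℓ} {D : Set a} → Rel3 D ℓ → ℕ → ℕ → Set (a ⊔ ℓ)
NRD≥ P n k = ∃[ Y ] (NonRedundant {n = n} P Y × k ≤ length Y)

CondNRD≥ : ∀ {a ℓ ℓ′} {D : Set a} → Rel3 D ℓ → Rel3 D ℓ′ → ℕ → ℕ → Set (a ⊔ ℓ ⊔ ℓ′)
CondNRD≥ P Q n k = ∃[ Y ] (CondNonRedundant {n = n} P Q Y × k ≤ length Y)

module _ {c ℓ} (G : AbelianGroup c ℓ) where
  open AbelianGroup G

  3LIN : Rel3 Carrier ℓ
  3LIN x y z = (x ∙ y) ∙ z ≈ ε

  3LIN* : Rel3 Carrier ℓ
  3LIN* x y z = 3LIN x y z × ¬ (x ≈ ε × y ≈ ε × z ≈ ε)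

  HasOrder : ℕ → Set (c ⊔ ℓ)
  HasOrder m = Bijection (≡.setoid (Fin m)) setoid

-- Take as variables the 3m² edges of the complete tripartite graph on three copies of Fin m
-- and as clauses its m³ triangles (x_ij, y_jk, z_ik).  Given nonzero h ≠ s in G (this is where
-- |G| ≥ 3 enters), the triangle (i₀, j₀, k₀) is isolated by x_ij = p_i + q_j, y_jk = r_k − q_j,
-- z_ik = −(p_i + r_k), where p, q vanish exactly at i₀, j₀ and equal h elsewhere, and r vanishes
-- exactly at k₀ and equals s elsewhere.  Every triangle satisfies 3LIN, and x_ij = y_jk = 0 forces
-- r_k = q_j ∈ {0, s} ∩ {0, h} = {0}, hence j = j₀, k = k₀, then p_i = 0 and i = i₀.  Padding with
-- unused variables and taking m maximal with 3m² ≤ n yields m³ ≥ (n/12)^{3/2} clauses.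
{-# OPTIONS --safe #-}
module Submission where

open import Defs
open import Algebra.Bundles using (AbelianGroup)
open import Data.Nat using (ℕ; _≤_; _<_; _*_; _^_)
open import Data.Product using (_×_; ∃-syntax)

open import Level using (_⊔_)
open import Data.Nat using (suc; _+_; _∸_; z≤n; s≤s; _<?_)
open import Data.Nat.Properties
  using (≤-trans; ≤-reflexive; ≤-antisym; <⇒≤; <⇒≱; ≮⇒≥; m≤n⇒m≤1+n; m<m+n; m+[n∸m]≡n;
         +-monoˡ-≤; *-mono-≤; *-monoˡ-≤; *-monoʳ-≤; ^-monoˡ-≤; *-identityˡ; ≤ᵇ⇒≤; module ≤-Reasoning)
open import Data.Nat.Tactic.RingSolver using (solve-∀)
open import Data.Fin using (Fin; _↑ˡ_; splitAt; combine; remQuot; _≟_)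
open import Data.Fin.Patterns using (0F; 1F; 2F)
open import Data.Fin.Properties using (splitAt-↑ˡ; remQuot-combine; ↑ˡ-injective; combine-injective)
open import Data.Product using (_,_; proj₁; proj₂; uncurry)
open import Data.Sum using ([_,_])
open import Data.List using (List; []; _∷_; map; length; allFin; cartesianProduct; _++_)
open import Data.List.Properties using (length-map; length-++; length-tabulate)
open import Data.List.Membership.Propositional using (_∈_)
open import Data.List.Membership.Propositional.Properties using (∈-map⁻)
open import Data.List.Relation.Unary.Unique.Propositional using (Unique)
open import Data.List.Relation.Unary.Unique.Propositional.Properties using (map⁺; allFin⁺; cartesianProduct⁺)
open import Data.Empty using (⊥-elim)
open import Relation.Nullary using (¬_; yes; no)
open import Relation.Binary.PropositionalEquality
  using (_≡_; _≢_; refl; sym; trans; cong; cong₂; subst; module ≡-Reasoning)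
open import Function using (id; const; _∘_)
open import Function.Bundles using (Bijection; _⇔_; mk⇔; Equivalence)
import Algebra.Properties.Group as GroupProperties
import Algebra.Properties.CommutativeSemigroup as CommutativeSemigroupProperties
import Relation.Binary.Reasoning.Setoid as SetoidReasoning

Sat-⇔ : ∀ {a ℓ} {D : Set a} {R : Rel3 D ℓ} {n} {σ : Fin n → D} {x y z : Fin n} {u v w : D} →
        σ x ≡ u → σ y ≡ v → σ z ≡ w → Sat R σ (x , y , z) ⇔ R u v w
Sat-⇔ refl refl refl = mk⇔ id id

module _ {a ℓ ℓ′} {D : Set a} (P : Rel3 D ℓ) (Q : Rel3 D ℓ′) where

  condNRD≥⇒NRD≥ : ∀ n k → CondNRD≥ P Q n k → NRD≥ P n k
  condNRD≥⇒NRD≥ n k (Y , (unique , witness) , k≤|Y|) = Y , (unique , nonRedundant) , k≤|Y|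
    where
    nonRedundant : ∀ y → y ∈ Y → ∃[ σ ] (¬ Sat P σ y × (∀ y′ → y′ ∈ Y → y′ ≢ y → Sat P σ y′))
    nonRedundant y y∈Y = let σ , (_ , ¬Py) , P-others = witness y y∈Y in σ , ¬Py , P-others

  Separates : ∀ {n} {T : Set} → (T → Clause n) → List T → T → (Fin n → D) → Set (ℓ ⊔ ℓ′)
  Separates clause ts t₀ σ =
    (Sat Q σ (clause t₀) × ¬ Sat P σ (clause t₀)) × (∀ t → t ∈ ts → t ≢ t₀ → Sat P σ (clause t))

  map⁺-condNonRedundant : ∀ {n} {T : Set} {ts : List T} (clause : T → Clause n) →
                          (∀ {t t′} → clause t ≡ clause t′ → t ≡ t′) → Unique ts →
                          (∀ t₀ → t₀ ∈ ts → ∃[ σ ] Separates clause ts t₀ σ) →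
                          CondNonRedundant P Q (map clause ts)
  map⁺-condNonRedundant {ts = ts} clause clause-injective unique separate =
    map⁺ clause-injective unique , witness
    where
    witness : ∀ y → y ∈ map clause ts → ∃[ σ ] Separates id (map clause ts) y σ
    witness y y∈ with ∈-map⁻ clause y∈
    ... | t₀ , t₀∈ts , refl with separate t₀ t₀∈ts
    ...   | σ , isolated , P-others = σ , isolated , others
      where
      others : ∀ y′ → y′ ∈ map clause ts → y′ ≢ clause t₀ → Sat P σ y′
      others y′ y′∈ y′≢y with ∈-map⁻ clause y′∈
      ... | t , t∈ts , refl = P-others t t∈ts (y′≢y ∘ cong clause)

  pad : ∀ {n} r → Clause n → Clause (n + r)
  pad r (x , y , z) = x ↑ˡ r , y ↑ˡ r , z ↑ˡ r

  pad-injective : ∀ {n} r {c c′ : Clause n} → pad r c ≡ pad r c′ → c ≡ c′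
  pad-injective r {x , y , z} {x′ , y′ , z′} eq
    with refl ← ↑ˡ-injective r x x′ (cong proj₁ eq)
       | refl ← ↑ˡ-injective r y y′ (cong (proj₁ ∘ proj₂) eq)
       | refl ← ↑ˡ-injective r z z′ (cong (proj₂ ∘ proj₂) eq) = refl

  extend : ∀ {n} r → D → (Fin n → D) → Fin (n + r) → D
  extend {n} r d σ x = [ σ , const d ] (splitAt n x)

  Sat-pad : ∀ {ℓ″} (R : Rel3 D ℓ″) {n} r d (σ : Fin n → D) c →
            Sat R (extend r d σ) (pad r c) ⇔ Sat R σ c
  Sat-pad R {n} r d σ (x , y , z) =
    Sat-⇔ {R = R} {σ = extend r d σ} (extended x) (extended y) (extended z)
    where
    extended : ∀ x → extend r d σ (x ↑ˡ r) ≡ σ x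
    extended x = cong [ σ , const d ] (splitAt-↑ˡ n x r)

  condNRD≥-pad : ∀ {n k} r → D → CondNRD≥ P Q n k → CondNRD≥ P Q (n + r) k
  condNRD≥-pad r d (Y , (unique , witness) , k≤|Y|) =
    map (pad r) Y ,
    map⁺-condNonRedundant (pad r) (pad-injective r) unique separate ,
    ≤-trans k≤|Y| (≤-reflexive (sym (length-map (pad r) Y)))
    where
    separate : ∀ c₀ → c₀ ∈ Y → ∃[ σ ] Separates (pad r) Y c₀ σ
    separate c₀ c₀∈Y =
      let σ , (Qc₀ , ¬Pc₀) , P-others = witness c₀ c₀∈Y
          padded : ∀ {ℓ″} (R : Rel3 D ℓ″) c → Sat R (extend r d σ) (pad r c) ⇔ Sat R σ c
          padded R = Sat-pad R r d σ
      in extend r d σ ,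
         (Equivalence.from (padded Q c₀) Qc₀ , ¬Pc₀ ∘ Equivalence.to (padded P c₀)) ,
         λ c c∈Y c≢c₀ → Equivalence.from (padded P c) (P-others c c∈Y c≢c₀)

  condNRD≥-mono : ∀ {n n′ k} → D → n ≤ n′ → CondNRD≥ P Q n k → CondNRD≥ P Q n′ k
  condNRD≥-mono {n} {n′} {k} d n≤n′ nrd =
    subst (λ v → CondNRD≥ P Q v k) (m+[n∸m]≡n n≤n′) (condNRD≥-pad (n′ ∸ n) d nrd)

length-cartesianProduct : ∀ {a b} {A : Set a} {B : Set b} (xs : List A) (ys : List B) →
                          length (cartesianProduct xs ys) ≡ length xs * length ys
length-cartesianProduct [] ys = refl
length-cartesianProduct (x ∷ xs) ys = begin
  length (map (x ,_) ys ++ cartesianProduct xs ys)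
    ≡⟨ length-++ (map (x ,_) ys) ⟩
  length (map (x ,_) ys) + length (cartesianProduct xs ys)
    ≡⟨ cong₂ _+_ (length-map (x ,_) ys) (length-cartesianProduct xs ys) ⟩
  length ys + length xs * length ys
    ∎
  where open ≡-Reasoning

module Triangles (m : ℕ) where

  Triangle : Set
  Triangle = Fin m × Fin m × Fin m

  #edges : ℕ
  #edges = 3 * (m * m)

  edge : Fin 3 → Fin m → Fin m → Fin #edges
  edge side u v = combine side (combine u v)

  edge-injective : ∀ side u v u′ v′ → edge side u v ≡ edge side u′ v′ → u ≡ u′ × v ≡ v′
  edge-injective side u v u′ v′ eq = combine-injective u v u′ v′ (proj₂ (combine-injective side _ side _ eq))

  triangle : Triangle → Clause #edges
  triangle (i , j , k) = edge 0F i j , edge 1F j k , edge 2F i k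

  triangle-injective : ∀ {t t′} → triangle t ≡ triangle t′ → t ≡ t′
  triangle-injective {i , j , k} {i′ , j′ , k′} eq
    with refl , refl ← edge-injective 0F i j i′ j′ (cong proj₁ eq)
       | refl , refl ← edge-injective 1F j k j′ k′ (cong (proj₁ ∘ proj₂) eq) = refl

  triangles : List Triangle
  triangles = cartesianProduct (allFin m) (cartesianProduct (allFin m) (allFin m))

  triangles-unique : Unique triangles
  triangles-unique = cartesianProduct⁺ (allFin⁺ m) (cartesianProduct⁺ (allFin⁺ m) (allFin⁺ m))

  length-triangles : length triangles ≡ m * (m * m)
  length-triangles = begin
    length triangles
      ≡⟨ length-cartesianProduct (allFin m) _ ⟩
    length (allFin m) * length (cartesianProduct (allFin m) (allFin m))
      ≡⟨ cong₂ _*_ length-allFin (length-cartesianProduct (allFin m) (allFin m)) ⟩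
    m * (length (allFin m) * length (allFin m))
      ≡⟨ cong (m *_) (cong₂ _*_ length-allFin length-allFin) ⟩
    m * (m * m)
      ∎
    where
    open ≡-Reasoning
    length-allFin : length (allFin m) ≡ m
    length-allFin = length-tabulate {n = m} id

  edgeAssignment : ∀ {a} {D : Set a} → (Fin 3 → Fin m → Fin m → D) → Fin #edges → D
  edgeAssignment {D = D} value = onEdge ∘ remQuot (m * m)
    where
    onEdge : Fin 3 × Fin (m * m) → D
    onEdge (side , uv) = uncurry (value side) (remQuot {m} m uv)

  edgeAssignment-edge : ∀ {a} {D : Set a} (value : Fin 3 → Fin m → Fin m → D) side u v →
                        edgeAssignment value (edge side u v) ≡ value side u v
  edgeAssignment-edge value side u v =
    trans (cong (λ (side , uv) → uncurry (value side) (remQuot {m} m uv))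
                (remQuot-combine {k = m * m} side (combine u v)))
          (cong (uncurry (value side)) (remQuot-combine {k = m} u v))

  Sat-triangle : ∀ {a ℓ} {D : Set a} (R : Rel3 D ℓ) (value : Fin 3 → Fin m → Fin m → D) i j k →
                 Sat R (edgeAssignment value) (triangle (i , j , k))
                   ⇔ R (value 0F i j) (value 1F j k) (value 2F i k)
  Sat-triangle R value i j k = Sat-⇔ {R = R} {σ = edgeAssignment value}
    (edgeAssignment-edge value 0F i j) (edgeAssignment-edge value 1F j k) (edgeAssignment-edge value 2F i k)

module _ {c ℓ} (G : AbelianGroup c ℓ) where
  open AbelianGroup G hiding (refl; sym; trans)
  open AbelianGroup G using () renaming (refl to ≈-refl; sym to ≈-sym; trans to ≈-trans)
  open GroupProperties group using (x∙y⁻¹≈ε⇒x≈y; ∙-cancelʳ)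
  open CommutativeSemigroupProperties commutativeSemigroup using (interchange)
  open SetoidReasoning setoid

  3LIN-triangle : ∀ p q r → 3LIN G (p ∙ q) (r ∙ q ⁻¹) ((p ∙ r) ⁻¹)
  3LIN-triangle p q r = begin
    (p ∙ q) ∙ (r ∙ q ⁻¹) ∙ (p ∙ r) ⁻¹ ≈⟨ ∙-congʳ (interchange p q r (q ⁻¹)) ⟩
    (p ∙ r) ∙ (q ∙ q ⁻¹) ∙ (p ∙ r) ⁻¹ ≈⟨ ∙-congʳ (∙-congˡ (inverseʳ q)) ⟩
    (p ∙ r) ∙ ε ∙ (p ∙ r) ⁻¹          ≈⟨ ∙-congʳ (identityʳ (p ∙ r)) ⟩
    (p ∙ r) ∙ (p ∙ r) ⁻¹              ≈⟨ inverseʳ (p ∙ r) ⟩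
    ε                                 ∎

  3LIN-third-≈ε : ∀ {x y z} → 3LIN G x y z → x ≈ ε → y ≈ ε → z ≈ ε
  3LIN-third-≈ε {x} {y} {z} xyz≈ε x≈ε y≈ε = begin
    z         ≈⟨ identityˡ z ⟨
    ε ∙ z     ≈⟨ ∙-congʳ (identityˡ ε) ⟨
    ε ∙ ε ∙ z ≈⟨ ∙-congʳ (∙-cong x≈ε y≈ε) ⟨
    x ∙ y ∙ z ≈⟨ xyz≈ε ⟩
    ε         ∎

  nonzero-distinct-pair : ∀ {m} → HasOrder G m → 3 ≤ m → ∃[ h ] ∃[ s ] (¬ h ≈ ε × ¬ s ≈ ε × ¬ s ≈ h)
  nonzero-distinct-pair {m} order (s≤s (s≤s (s≤s _))) = g 1F ∙ g 0F ⁻¹ , g 2F ∙ g 0F ⁻¹ , h≉ε , s≉ε , s≉h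
    where
    g : Fin m → Carrier
    g = Bijection.to order
    g-injective : ∀ {x y} → g x ≈ g y → x ≡ y
    g-injective = Bijection.injective order
    h≉ε : ¬ g 1F ∙ g 0F ⁻¹ ≈ ε
    h≉ε e with g-injective (x∙y⁻¹≈ε⇒x≈y _ _ e)
    ... | ()
    s≉ε : ¬ g 2F ∙ g 0F ⁻¹ ≈ ε
    s≉ε e with g-injective (x∙y⁻¹≈ε⇒x≈y _ _ e)
    ... | ()
    s≉h : ¬ g 2F ∙ g 0F ⁻¹ ≈ g 1F ∙ g 0F ⁻¹
    s≉h e with g-injective (∙-cancelʳ (g 0F ⁻¹) _ _ e)
    ... | ()

  module TriangleInstance (h s : Carrier) (h≉ε : ¬ h ≈ ε) (s≉ε : ¬ s ≈ ε) (s≉h : ¬ s ≈ h) (m : ℕ) where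
    open Triangles m

    outside : Fin m → Carrier → Fin m → Carrier
    outside i₀ x i with i ≟ i₀
    ... | yes _ = ε
    ... | no _  = x

    outside-at : ∀ i₀ x → outside i₀ x i₀ ≈ ε
    outside-at i₀ x with i₀ ≟ i₀
    ... | yes _     = ≈-refl
    ... | no i₀≢i₀ = ⊥-elim (i₀≢i₀ refl)

    outside-≈ε : ∀ {i₀ x i} → ¬ x ≈ ε → outside i₀ x i ≈ ε → i ≡ i₀
    outside-≈ε {i₀} {x} {i} x≉ε with i ≟ i₀
    ... | yes i≡i₀ = const i≡i₀
    ... | no _     = ⊥-elim ∘ x≉ε

    outside-s≈outside-h : ∀ {j₀ k₀ j k} → outside k₀ s k ≈ outside j₀ h j → k ≡ k₀ × j ≡ j₀
    outside-s≈outside-h {j₀} {k₀} {j} {k} e with k ≟ k₀ | j ≟ j₀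
    ... | yes k≡k₀ | yes j≡j₀ = k≡k₀ , j≡j₀
    ... | yes _    | no _     = ⊥-elim (h≉ε (≈-sym e))
    ... | no _     | yes _    = ⊥-elim (s≉ε e)
    ... | no _     | no _     = ⊥-elim (s≉h e)

    value : Triangle → Fin 3 → Fin m → Fin m → Carrier
    value (i₀ , j₀ , k₀) 0F i j = outside i₀ h i ∙ outside j₀ h j
    value (i₀ , j₀ , k₀) 1F j k = outside k₀ s k ∙ outside j₀ h j ⁻¹
    value (i₀ , j₀ , k₀) 2F i k = (outside i₀ h i ∙ outside k₀ s k) ⁻¹

    value-3LIN : ∀ t₀ i j k → 3LIN G (value t₀ 0F i j) (value t₀ 1F j k) (value t₀ 2F i k)
    value-3LIN (i₀ , j₀ , k₀) i j k = 3LIN-triangle (outside i₀ h i) (outside j₀ h j) (outside k₀ s k)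

    value-vanishes-at : ∀ i₀ j₀ k₀ →
                        value (i₀ , j₀ , k₀) 0F i₀ j₀ ≈ ε × value (i₀ , j₀ , k₀) 1F j₀ k₀ ≈ ε
    value-vanishes-at i₀ j₀ k₀ =
      ≈-trans (∙-cong (outside-at i₀ h) (outside-at j₀ h)) (identityˡ ε) ,
      ≈-trans (∙-cong (outside-at k₀ s) (⁻¹-cong (outside-at j₀ h))) (inverseʳ ε)

    value-vanishes-only-at : ∀ t₀ {i j k} → value t₀ 0F i j ≈ ε → value t₀ 1F j k ≈ ε → (i , j , k) ≡ t₀
    value-vanishes-only-at (i₀ , j₀ , k₀) {i} {j} {k} a≈ε b≈ε
      with refl , refl ← outside-s≈outside-h {j₀} {k₀} {j} {k} (x∙y⁻¹≈ε⇒x≈y _ _ b≈ε) =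
      cong (_, j₀ , k₀) (outside-≈ε h≉ε (begin
        outside i₀ h i                   ≈⟨ identityʳ _ ⟨
        outside i₀ h i ∙ ε               ≈⟨ ∙-congˡ (outside-at j₀ h) ⟨
        outside i₀ h i ∙ outside j₀ h j₀ ≈⟨ a≈ε ⟩
        ε                                ∎))

    separates : ∀ t₀ → Separates (3LIN* G) (3LIN G) triangle triangles t₀ (edgeAssignment (value t₀))
    separates t₀@(i₀ , j₀ , k₀) =
      (Equivalence.from (Sat-triangle (3LIN G) (value t₀) i₀ j₀ k₀) (value-3LIN t₀ i₀ j₀ k₀) , violated) ,
      others
      where
      violated : ¬ Sat (3LIN* G) (edgeAssignment (value t₀)) (triangle t₀)
      violated sat with Equivalence.to (Sat-triangle (3LIN* G) (value t₀) i₀ j₀ k₀) sat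
      ... | lin , nonzero = let a≈ε , b≈ε = value-vanishes-at i₀ j₀ k₀ in
                            nonzero (a≈ε , b≈ε , 3LIN-third-≈ε lin a≈ε b≈ε)

      others : ∀ t → t ∈ triangles → t ≢ t₀ → Sat (3LIN* G) (edgeAssignment (value t₀)) (triangle t)
      others t@(i , j , k) _ t≢t₀ = Equivalence.from (Sat-triangle (3LIN* G) (value t₀) i j k)
        (value-3LIN t₀ i j k , λ (a≈ε , b≈ε , _) → t≢t₀ (value-vanishes-only-at t₀ a≈ε b≈ε))

    condNRD≥-triangles : CondNRD≥ (3LIN* G) (3LIN G) (3 * (m * m)) (m * (m * m))
    condNRD≥-triangles =
      map triangle triangles ,
      map⁺-condNonRedundant (3LIN* G) (3LIN G) triangle triangle-injective triangles-unique
        (λ t₀ _ → edgeAssignment (value t₀) , separates t₀) ,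
      ≤-reflexive (sym (trans (length-map triangle triangles) length-triangles))

∃-largest-≤ : (f : ℕ → ℕ) → f 0 ≡ 0 → (∀ q → f q < f (suc q)) →
              ∀ n → ∃[ q ] (f q ≤ n × n < f (suc q))
∃-largest-≤ f f0≡0 f-increasing 0 = 0 , ≤-reflexive f0≡0 , subst (_< f 1) f0≡0 (f-increasing 0)
∃-largest-≤ f f0≡0 f-increasing (suc n) with ∃-largest-≤ f f0≡0 f-increasing n
... | q , fq≤n , n<f[1+q] with suc n <? f (suc q)
...   | yes 1+n<f[1+q] = q , m≤n⇒m≤1+n fq≤n , 1+n<f[1+q]
...   | no 1+n≮f[1+q] =
  suc q , ≤-reflexive (sym 1+n≡f[1+q]) , subst (_< f (suc (suc q))) (sym 1+n≡f[1+q]) (f-increasing (suc q))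
  where
  1+n≡f[1+q] : suc n ≡ f (suc q)
  1+n≡f[1+q] = ≤-antisym n<f[1+q] (≮⇒≥ 1+n≮f[1+q])

3*square-increasing : ∀ q → 3 * (q * q) < 3 * (suc q * suc q)
3*square-increasing q = subst (3 * (q * q) <_) (sym (expand q)) (m<m+n (3 * (q * q)) (s≤s z≤n))
  where
  expand : ∀ q → 3 * (suc q * suc q) ≡ 3 * (q * q) + suc (6 * q + 2)
  expand = solve-∀

3≤3[1+q]²⇒1≤q : ∀ {n} q → 3 ≤ n → n < 3 * (suc q * suc q) → 1 ≤ q
3≤3[1+q]²⇒1≤q 0       3≤n n<3 = ⊥-elim (<⇒≱ n<3 3≤n)
3≤3[1+q]²⇒1≤q (suc _) _   _   = s≤s z≤n

<3[1+q]²⇒≤12q² : ∀ {n} q → 1 ≤ q → n < 3 * (suc q * suc q) → n ≤ 12 * (q * q)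
<3[1+q]²⇒≤12q² {n} q 1≤q n<3[1+q]² = begin
  n                       ≤⟨ <⇒≤ n<3[1+q]² ⟩
  3 * (suc q * suc q)     ≤⟨ *-monoʳ-≤ 3 (*-mono-≤ 1+q≤q+q 1+q≤q+q) ⟩
  3 * ((q + q) * (q + q)) ≡⟨ quadruple q ⟩
  12 * (q * q)            ∎
  where
  open ≤-Reasoning
  1+q≤q+q : suc q ≤ q + q
  1+q≤q+q = +-monoˡ-≤ q 1≤q
  quadruple : ∀ q → 3 * ((q + q) * (q + q)) ≡ 12 * (q * q)
  quadruple = solve-∀

cube-bound : ∀ {n} q → n ≤ 12 * (q * q) → n ^ 3 ≤ 42 ^ 2 * (q * (q * q)) ^ 2
cube-bound {n} q n≤12q² = begin
  n ^ 3                      ≤⟨ ^-monoˡ-≤ 3 n≤12q² ⟩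
  (12 * (q * q)) ^ 3         ≡⟨ cube 12 q ⟩
  12 ^ 3 * (q * (q * q)) ^ 2 ≤⟨ *-monoˡ-≤ ((q * (q * q)) ^ 2) (≤ᵇ⇒≤ (12 ^ 3) (42 ^ 2) _) ⟩
  42 ^ 2 * (q * (q * q)) ^ 2 ∎
  where
  open ≤-Reasoning
  cube : ∀ c q → (c * (q * q)) * ((c * (q * q)) * ((c * (q * q)) * 1))
               ≡ (c * (c * (c * 1))) * ((q * (q * q)) * ((q * (q * q)) * 1))
  cube = solve-∀

theorem6p8 : ∀ {c ℓ} (G : AbelianGroup c ℓ) (m : ℕ) → HasOrder G m → 3 ≤ m →
    (∀ n k → CondNRD≥ (3LIN* G) (3LIN G) n k → NRD≥ (3LIN* G) n k)
    × (∃[ a ] ∃[ b ] ∃[ N ] (0 < a × 0 < b ×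
        (∀ n → N ≤ n → ∃[ k ] (CondNRD≥ (3LIN* G) (3LIN G) n k
                               × a ^ 2 * n ^ 3 ≤ b ^ 2 * k ^ 2))))
theorem6p8 G m order 3≤m = condNRD≥⇒NRD≥ (3LIN* G) (3LIN G) , 1 , 42 , 3 , s≤s z≤n , s≤s z≤n , growth
  where
  growth : ∀ n → 3 ≤ n → ∃[ k ] (CondNRD≥ (3LIN* G) (3LIN G) n k × 1 ^ 2 * n ^ 3 ≤ 42 ^ 2 * k ^ 2)
  growth n 3≤n with nonzero-distinct-pair G order 3≤m
                  | ∃-largest-≤ (λ q → 3 * (q * q)) refl 3*square-increasing n
  ... | h , s , h≉ε , s≉ε , s≉h | q , 3q²≤n , n<3[1+q]² =
    q * (q * q) ,
    condNRD≥-mono (3LIN* G) (3LIN G) (AbelianGroup.ε G) 3q²≤n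
      (TriangleInstance.condNRD≥-triangles G h s h≉ε s≉ε s≉h q) ,
    ≤-trans (≤-reflexive (*-identityˡ (n ^ 3)))
            (cube-bound q (<3[1+q]²⇒≤12q² q (3≤3[1+q]²⇒1≤q q 3≤n n<3[1+q]²) n<3[1+q]²))
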